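{- Let $k,\ell\ge0$ and $1\le m\le n$ be integers, let $\pi=\pi_1\cdots\pi_n\in\mathfrak{S}_{m,n}$ and let $i\in[n]$ with $\pi_i>0$. Consider the street with spots $1,\dots,n$ in which exactly the spots $u$ with $0<\pi_u<\pi_i$ are occupied. Let $\mathrm{F}(\pi_i)$ be the number of preferences $a$ for car $\pi_i$ such that car $\pi_i$ finds spot $a$ occupied, fails to park while backing up, and then moves forward into spot $i$ under the $(k,\ell)$-pullback rule (necessarily $a<i$). Then \[ \mathrm{F}(\pi_i)=\begin{cases}0 & \text{if } \mathrm{Left}(\pi_i)=0,\\ \min(i-1,\ell) & \text{if } 0<\mathrm{Left}(\pi_i)=i-1,\\ \max(\min(\mathrm{Left}(\pi_i)-k,\ell),0) & \text{if } 0<\mathrm{Left}(\pi_i)<i-1.\end{cases} \] (By convention $\mathrm{F}(0)=0$.)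
   Context: $(k,\ell)$-pullback parking rule: a car with preference $a$ drives to spot $a$ and parks there if it is empty; otherwise it checks spots $a-1,a-2,\dots,a-k$ in this order (stopping if it reaches the start of the street, i.e., spot $1$) and parks in the first empty one; if none is found, it checks spots $a+1,\dots,a+\ell$ in order (not beyond spot $n$) and parks in the first empty one; otherwise it fails to park. $\mathfrak{S}_{m,n}$ is the set of words $\pi_1\cdots\pi_n$ that are permutations of the multiset of $n-m$ zeros and the elements of $[m]$; the outcome of a parking function has $\pi_u=j$ if car $j$ parks in spot $u$ and $\pi_u=0$ if spot $u$ is vacant. $\mathrm{Left}(\pi_i)$ is the largest $x\ge 0$ such that $0<\pi_t<\pi_i$ for all $i-x\le t\le i-1$ (with $i-x\ge1$). -}

module Defs where

open import Data.Nat using (ℕ; zero; suc; _+_; _∸_; _≤_; _<_; _<ᵇ_; _≤ᵇ_; _⊓_; _⊔_)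
open import Data.Bool using (Bool; true; false; _∧_; not; if_then_else_; T)
open import Data.List using (List; []; _∷_; _++_; replicate; map; upTo)
open import Data.List.Relation.Binary.Permutation.Propositional using (_↭_)
open import Data.Maybe using (Maybe; just; nothing)
open import Data.Product using (_×_)

-- A word π = π₁⋯πₙ is a list of naturals; get π u = π_u (1-based), 0 out of range.
get : List ℕ → ℕ → ℕ
get []       _             = 0
get (x ∷ xs) zero          = 0
get (x ∷ xs) (suc zero)    = x
get (x ∷ xs) (suc (suc u)) = get xs (suc u)

InS : ℕ → ℕ → List ℕ → Set
InS m n π = π ↭ (replicate (n ∸ m) 0 ++ map suc (upTo m))

occ : List ℕ → ℕ → ℕ → Bool
occ π i u = (0 <ᵇ get π u) ∧ (get π u <ᵇ get π i)

LeftOK : List ℕ → ℕ → ℕ → Set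
LeftOK π i x = (x ≤ i ∸ 1) × (∀ t → i ∸ x ≤ t → t < i → T (occ π i t))


IsLeft : List ℕ → ℕ → ℕ → Set
IsLeft π i x = LeftOK π i x × (∀ y → LeftOK π i y → y ≤ x)


back : (ℕ → Bool) → ℕ → ℕ → Maybe ℕ
back free zero    _       = nothing
back free (suc c) zero    = nothing
back free (suc c) (suc j) = if free (suc c) then just (suc c) else back free c j

fwd : (ℕ → Bool) → ℕ → ℕ → ℕ → Maybe ℕ
fwd free n c zero    = nothing
fwd free n c (suc j) = if c ≤ᵇ n then (if free c then just c else fwd free n (suc c) j) else nothing

isNothing : Maybe ℕ → Bool
isNothing nothing  = true
isNothing (just _) = false

isJust= : ℕ → Maybe ℕ → Bool
isJust= i nothing  = false
isJust= i (just u) = (u ≤ᵇ i) ∧ (i ≤ᵇ u)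

countsF : ℕ → ℕ → ℕ → List ℕ → ℕ → ℕ → Bool
countsF k ℓ n π i a =
  let free = λ u → not (occ π i u) in
  occ π i a ∧ isNothing (back free (a ∸ 1) k) ∧ isJust= i (fwd free n (a + 1) ℓ)

countUpTo : (ℕ → Bool) → ℕ → ℕ
countUpTo P zero    = 0
countUpTo P (suc N) = (if P (suc N) then 1 else 0) + countUpTo P N

F : ℕ → ℕ → ℕ → List ℕ → ℕ → ℕ
F k ℓ n π i = countUpTo (countsF k ℓ n π i) n

-- Write i = i′ + 1 and r = i′ − L, so that spots r+1,…,i′ are occupied, spot i is vacant, and so is
-- spot r unless r = 0 (the run of occupied spots reaches the start of the street). A preference a is
-- counted iff it lies in the run (r < a ≤ i′), spot i is within reach (i′ − ℓ < a), and backing up from a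
-- cannot reach the vacant spot r (r = 0 or r + k < a). The counted preferences thus form the interval
-- (i′ − ℓ, i′] when r = 0, of length min(i′, ℓ), and ((r + k) ⊔ (i′ − ℓ), i′] when r ≥ 1, of length
-- min(L − k, ℓ).
module Submission where

open import Defs
open import Data.Bool using (Bool; true; false; not; T; _∧_)
open import Data.Bool.Properties using (T-≡; T-∧; ¬-not)
open import Data.List using (List)
open import Data.Maybe using (Maybe; just; nothing)
open import Data.Nat
  using (ℕ; zero; suc; _+_; _∸_; _⊓_; _⊔_; _≤_; _<_; _<ᵇ_; _≤ᵇ_; z≤n; s≤s; s≤s⁻¹; _≤′_; ≤′-refl; ≤′-step)
open import Data.Nat.Properties
open import Data.Product using (_×_; _,_; proj₂)
open import Data.Sum using (_⊎_; inj₁; inj₂)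
open import Function.Base using (case_of_)
open import Function.Bundles using (_⇔_; mk⇔; Equivalence)
open import Relation.Binary.PropositionalEquality
  using (_≡_; refl; sym; trans; cong; subst; module ≡-Reasoning)
open import Relation.Nullary using (yes; no; contradiction)

open Equivalence using (to; from)

countUpTo-false : ∀ (P : ℕ → Bool) {M N} → M ≤ N → (∀ a → M < a → a ≤ N → P a ≡ false) →
                  countUpTo P N ≡ countUpTo P M
countUpTo-false P M≤N = go (≤⇒≤′ M≤N)
  where
  go : ∀ {M N} → M ≤′ N → (∀ a → M < a → a ≤ N → P a ≡ false) → countUpTo P N ≡ countUpTo P M
  go ≤′-refl           _ = refl
  go (≤′-step {N} M≤′N) h rewrite h (suc N) (s≤s (≤′⇒≤ M≤′N)) ≤-refl =
    go M≤′N (λ a M<a a≤N → h a M<a (m≤n⇒m≤1+n a≤N))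

countUpTo-true : ∀ (P : ℕ → Bool) M d → (∀ a → M < a → a ≤ d + M → P a ≡ true) →
                 countUpTo P (d + M) ≡ d + countUpTo P M
countUpTo-true P M zero    _ = refl
countUpTo-true P M (suc d) h rewrite h (suc (d + M)) (s≤s (m≤n+m M d)) ≤-refl =
  cong suc (countUpTo-true P M d (λ a M<a a≤d+M → h a M<a (m≤n⇒m≤1+n a≤d+M)))

countUpTo-interval : ∀ (P : ℕ → Bool) {s t N} → t ≤ N →
                     (∀ a → s < a → a ≤ t → P a ≡ true) →
                     (∀ a → 1 ≤ a → a ≤ N → (a ≤ s ⊎ t < a) → P a ≡ false) →
                     countUpTo P N ≡ t ∸ s
countUpTo-interval P {s} {t} {N} t≤N inside outside with s ≤? t
... | yes s≤t = begin
  countUpTo P N            ≡⟨ countUpTo-false P t≤N above ⟩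
  countUpTo P t            ≡⟨ cong (countUpTo P) (sym (m∸n+n≡m s≤t)) ⟩
  countUpTo P (t ∸ s + s)  ≡⟨ countUpTo-true P s (t ∸ s) within ⟩
  t ∸ s + countUpTo P s    ≡⟨ cong (t ∸ s +_) (countUpTo-false P z≤n below) ⟩
  t ∸ s + 0                ≡⟨ +-identityʳ (t ∸ s) ⟩
  t ∸ s                    ∎
  where
  open ≡-Reasoning
  above : ∀ a → t < a → a ≤ N → P a ≡ false
  above a t<a a≤N = outside a (≤-trans (s≤s z≤n) t<a) a≤N (inj₂ t<a)
  within : ∀ a → s < a → a ≤ t ∸ s + s → P a ≡ true
  within a s<a a≤t = inside a s<a (subst (a ≤_) (m∸n+n≡m s≤t) a≤t)
  below : ∀ a → 0 < a → a ≤ s → P a ≡ false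
  below a 0<a a≤s = outside a 0<a (≤-trans a≤s (≤-trans s≤t t≤N)) (inj₁ a≤s)
... | no s≰t = begin
  countUpTo P N  ≡⟨ countUpTo-false P z≤n (λ a 0<a a≤N → outside a 0<a a≤N (below-or-above a)) ⟩
  0              ≡⟨ sym (m≤n⇒m∸n≡0 (<⇒≤ (≰⇒> s≰t))) ⟩
  t ∸ s          ∎
  where
  open ≡-Reasoning
  below-or-above : ∀ a → a ≤ s ⊎ t < a
  below-or-above a with a ≤? t
  ... | yes a≤t = inj₁ (≤-trans a≤t (<⇒≤ (≰⇒> s≰t)))
  ... | no a≰t = inj₂ (≰⇒> a≰t)

isJust=≡true⇔ : ∀ i (m : Maybe ℕ) → isJust= i m ≡ true ⇔ m ≡ just i
isJust=≡true⇔ i nothing  = mk⇔ (λ ()) (λ ())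
isJust=≡true⇔ i (just u) = mk⇔ sound complete
  where
  sound : ((u ≤ᵇ i) ∧ (i ≤ᵇ u)) ≡ true → just u ≡ just i
  sound eq with to T-∧ (from T-≡ eq)
  ... | u≤ᵇi , i≤ᵇu = cong just (≤-antisym (≤ᵇ⇒≤ u i u≤ᵇi) (≤ᵇ⇒≤ i u i≤ᵇu))
  complete : just u ≡ just i → ((u ≤ᵇ i) ∧ (i ≤ᵇ u)) ≡ true
  complete refl = to T-≡ (from T-∧ (≤⇒≤ᵇ (≤-refl {i}) , ≤⇒≤ᵇ (≤-refl {i})))

∧-isNothing-isJust=≡true⇔ : ∀ x (m m′ : Maybe ℕ) i →
  (x ∧ isNothing m ∧ isJust= i m′) ≡ true ⇔ (x ≡ true × m ≡ nothing × m′ ≡ just i)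
∧-isNothing-isJust=≡true⇔ true  nothing  m′ i = mk⇔ (λ eq → refl , refl , to (isJust=≡true⇔ i m′) eq)
                                                    (λ (_ , _ , eq) → from (isJust=≡true⇔ i m′) eq)
∧-isNothing-isJust=≡true⇔ true  (just _) m′ i = mk⇔ (λ ()) (λ ())
∧-isNothing-isJust=≡true⇔ false m        m′ i = mk⇔ (λ ()) (λ ())

vacant : List ℕ → ℕ → ℕ → Bool
vacant π i u = not (occ π i u)

Counted : ℕ → ℕ → ℕ → List ℕ → ℕ → ℕ → Set
Counted k ℓ n π i a =
  occ π i a ≡ true × back (vacant π i) (a ∸ 1) k ≡ nothing × fwd (vacant π i) n (suc a) ℓ ≡ just i

countsF≡true⇔ : ∀ k ℓ n π i a → countsF k ℓ n π i a ≡ true ⇔ Counted k ℓ n π i a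
countsF≡true⇔ k ℓ n π i a rewrite +-comm a 1 =
  ∧-isNothing-isJust=≡true⇔ (occ π i a) (back (vacant π i) (a ∸ 1) k) (fwd (vacant π i) n (suc a) ℓ) i

occ-self : ∀ π i → occ π i i ≡ false
occ-self π i = ¬-not λ occ≡true →
  <-irrefl refl (<ᵇ⇒< (get π i) (get π i) (proj₂ (to (T-∧ {0 <ᵇ get π i}) (from T-≡ occ≡true))))

back≡nothing⇒ : ∀ f c j → back f c j ≡ nothing → ∀ t → 1 ≤ t → t ≤ c → c < t + j → f t ≡ false
back≡nothing⇒ f zero    j       _  t 1≤t t≤0 _ = contradiction t≤0 (<⇒≱ 1≤t)
back≡nothing⇒ f (suc c) zero    _  t _ t≤c c<t+0 = contradiction (subst (suc c <_) (+-identityʳ t) c<t+0) (≤⇒≯ t≤c)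
back≡nothing⇒ f (suc c) (suc j) eq t 1≤t t≤c c<t+j with f (suc c) in fc
back≡nothing⇒ f (suc c) (suc j) () t 1≤t t≤c c<t+j | true
... | false with m≤n⇒m<n∨m≡n t≤c
...   | inj₂ refl = fc
...   | inj₁ t<c  = back≡nothing⇒ f c j eq t 1≤t (s≤s⁻¹ t<c) (s≤s⁻¹ (subst (suc c <_) (+-suc t j) c<t+j))

back≡nothing⇐ : ∀ f c j → (∀ t → 1 ≤ t → t ≤ c → c < t + j → f t ≡ false) → back f c j ≡ nothing
back≡nothing⇐ f zero    j       _ = refl
back≡nothing⇐ f (suc c) zero    _ = refl
back≡nothing⇐ f (suc c) (suc j) h rewrite h (suc c) (s≤s z≤n) ≤-refl (m<m+n (suc c) {suc j} (s≤s z≤n)) =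
  back≡nothing⇐ f c j λ t 1≤t t≤c c<t+j →
    h t 1≤t (m≤n⇒m≤1+n t≤c) (subst (suc c <_) (sym (+-suc t j)) (s≤s c<t+j))

fwd≡just⇒ : ∀ f n c j {u} → fwd f n c j ≡ just u →
            c ≤ u × u < c + j × (∀ t → c ≤ t → t < u → f t ≡ false)
fwd≡just⇒ f n c zero    ()
fwd≡just⇒ f n c (suc j) {u} eq with c ≤ᵇ n
fwd≡just⇒ f n c (suc j) () | false
... | true with f c in fc
fwd≡just⇒ f n c (suc j) refl | true | true =
  ≤-refl , subst (c <_) (sym (+-suc c j)) (s≤s (m≤m+n c j)) , λ t c≤t t<c → contradiction c≤t (<⇒≱ t<c)
... | false with fwd≡just⇒ f n (suc c) j eq
...   | c<u , u<c+j , none = <⇒≤ c<u , subst (u <_) (sym (+-suc c j)) u<c+j , none′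
  where
  none′ : ∀ t → c ≤ t → t < u → f t ≡ false
  none′ t c≤t t<u with m≤n⇒m<n∨m≡n c≤t
  ... | inj₂ refl = fc
  ... | inj₁ c<t  = none t c<t t<u

fwd≡just⇐ : ∀ f n c j {u} → c ≤ u → u ≤ n → u < c + j → f u ≡ true →
            (∀ t → c ≤ t → t < u → f t ≡ false) → fwd f n c j ≡ just u
fwd≡just⇐ f n c zero    {u} c≤u _ u<c+0 _ _ = contradiction (subst (u <_) (+-identityʳ c) u<c+0) (≤⇒≯ c≤u)
fwd≡just⇐ f n c (suc j) {u} c≤u u≤n u<c+j fu none rewrite to T-≡ (≤⇒≤ᵇ (≤-trans c≤u u≤n)) with m≤n⇒m<n∨m≡n c≤u
... | inj₂ refl rewrite fu = refl
... | inj₁ c<u  rewrite none c ≤-refl c<u =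
  fwd≡just⇐ f n (suc c) j c<u u≤n (subst (u <_) (+-suc c j) u<c+j) fu (λ t c<t t<u → none t (<⇒≤ c<t) t<u)

m∸[m∸n]≡m⊓n : ∀ m n → m ∸ (m ∸ n) ≡ m ⊓ n
m∸[m∸n]≡m⊓n m n with ≤-total m n
... | inj₁ m≤n rewrite m≤n⇒m∸n≡0 m≤n = sym (m≤n⇒m⊓n≡m m≤n)
... | inj₂ n≤m = trans (m∸[m∸n]≡n n≤m) (sym (m≥n⇒m⊓n≡n n≤m))

m∸[n⊔[m∸o]]≡[m∸n]⊓o : ∀ m n o → m ∸ (n ⊔ (m ∸ o)) ≡ (m ∸ n) ⊓ o
m∸[n⊔[m∸o]]≡[m∸n]⊓o m n o = begin
  m ∸ (n ⊔ (m ∸ o))        ≡⟨ ∸-distribˡ-⊔-⊓ m n (m ∸ o) ⟩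
  (m ∸ n) ⊓ (m ∸ (m ∸ o))  ≡⟨ cong ((m ∸ n) ⊓_) (m∸[m∸n]≡m⊓n m o) ⟩
  (m ∸ n) ⊓ (m ⊓ o)        ≡⟨ sym (⊓-assoc (m ∸ n) m o) ⟩
  ((m ∸ n) ⊓ m) ⊓ o        ≡⟨ cong (_⊓ o) (m≤n⇒m⊓n≡m (m∸n≤m m n)) ⟩
  (m ∸ n) ⊓ o              ∎
  where open ≡-Reasoning

m∸n<o⇒m<n+o : ∀ m n {o} → m ∸ n < o → m < n + o
m∸n<o⇒m<n+o m n m∸n<o = ≤-<-trans (m≤n+m∸n m n) (+-monoʳ-< n m∸n<o)

module OccupiedRun (k ℓ n : ℕ) (π : List ℕ) {i′ r : ℕ} (i≤n : suc i′ ≤ n) (r≤i′ : r ≤ i′)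
           (run : ∀ t → r < t → t ≤ i′ → occ π (suc i′) t ≡ true)
           (hole : 1 ≤ r → occ π (suc i′) r ≡ false) where

  vacant-run : ∀ t → r < t → t ≤ i′ → vacant π (suc i′) t ≡ false
  vacant-run t r<t t≤i′ rewrite run t r<t t≤i′ = refl

  vacant-hole : 1 ≤ r → vacant π (suc i′) r ≡ true
  vacant-hole 1≤r rewrite hole 1≤r = refl

  counted : ∀ a → r < a → a ≤ i′ → i′ ∸ ℓ < a → (r ≡ 0 ⊎ r + k < a) → countsF k ℓ n π (suc i′) a ≡ true
  counted (suc a) r<1+a a<i′ i′∸ℓ≤a backsUpFully = from (countsF≡true⇔ k ℓ n π (suc i′) (suc a))
    ( run (suc a) r<1+a a<i′
    , back≡nothing⇐ (vacant π (suc i′)) a k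
        (λ t 1≤t t≤a a<t+k → vacant-run t (r<t backsUpFully 1≤t a<t+k) (≤-trans t≤a (<⇒≤ a<i′)))
    , fwd≡just⇐ (vacant π (suc i′)) n (suc (suc a)) ℓ (s≤s a<i′) i≤n
        (s≤s (subst (i′ <_) (+-comm ℓ (suc a)) (m∸n<o⇒m<n+o i′ ℓ i′∸ℓ≤a)))
        (cong not (occ-self π (suc i′)))
        (λ t 1+a<t t≤i′ → vacant-run t (<-trans r<1+a 1+a<t) (s≤s⁻¹ t≤i′)) )
    where
    r<t : (r ≡ 0 ⊎ r + k < suc a) → ∀ {t} → 1 ≤ t → a < t + k → r < t
    r<t (inj₁ refl) 1≤t _       = 1≤t
    r<t (inj₂ r+k≤a) _  a<t+k = +-cancelʳ-< k r _ (≤-<-trans (s≤s⁻¹ r+k≤a) a<t+k)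

  uncounted-right : ∀ a → i′ < a → countsF k ℓ n π (suc i′) a ≡ false
  uncounted-right a i′<a = ¬-not λ isCounted →
    let (_ , _ , reaches) = to (countsF≡true⇔ k ℓ n π (suc i′) a) isCounted
        (1+a≤i , _ , _)   = fwd≡just⇒ (vacant π (suc i′)) n (suc a) ℓ reaches
    in contradiction (s≤s⁻¹ 1+a≤i) (<⇒≱ i′<a)

  uncounted-far : ∀ a → 1 ≤ a → a ≤ i′ ∸ ℓ → countsF k ℓ n π (suc i′) a ≡ false
  uncounted-far (suc a) _ a<i′∸ℓ = ¬-not λ isCounted →
    let (_ , _ , reaches) = to (countsF≡true⇔ k ℓ n π (suc i′) (suc a)) isCounted
        (_ , i<2+a+ℓ , _) = fwd≡just⇒ (vacant π (suc i′)) n (suc (suc a)) ℓ reaches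
        i′<ℓ+1+a          = subst (i′ <_) (+-comm (suc a) ℓ) (s≤s⁻¹ i<2+a+ℓ)
    in contradiction (m<n+o⇒m∸n<o i′ ℓ i′<ℓ+1+a) (≤⇒≯ a<i′∸ℓ)

  uncounted-atOrBeforeHole : ∀ a → 1 ≤ r → a ≤ r → countsF k ℓ n π (suc i′) a ≡ false
  uncounted-atOrBeforeHole a 1≤r a≤r = ¬-not λ isCounted →
    let (occupied , _ , reaches) = to (countsF≡true⇔ k ℓ n π (suc i′) a) isCounted
        (_ , _ , passes)         = fwd≡just⇒ (vacant π (suc i′)) n (suc a) ℓ reaches
    in case m≤n⇒m<n∨m≡n a≤r of λ where
         (inj₂ refl) → contradiction (trans (sym occupied) (hole 1≤r)) λ ()
         (inj₁ a<r)  → contradiction (trans (sym (passes r a<r (s≤s r≤i′))) (vacant-hole 1≤r)) λ ()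

  uncounted-backsIntoHole : ∀ a → 1 ≤ r → r < a → a ≤ r + k → countsF k ℓ n π (suc i′) a ≡ false
  uncounted-backsIntoHole (suc a) 1≤r r<1+a 1+a≤r+k = ¬-not λ isCounted →
    let (_ , blocked , _) = to (countsF≡true⇔ k ℓ n π (suc i′) (suc a)) isCounted
    in contradiction (trans (sym (back≡nothing⇒ (vacant π (suc i′)) a k blocked r 1≤r (s≤s⁻¹ r<1+a) 1+a≤r+k))
                            (vacant-hole 1≤r)) λ ()

  F-runFromStart : r ≡ 0 → F k ℓ n π (suc i′) ≡ i′ ⊓ ℓ
  F-runFromStart r≡0 = trans (countUpTo-interval (countsF k ℓ n π (suc i′)) (<⇒≤ i≤n) inside outside)
                             (m∸[m∸n]≡m⊓n i′ ℓ)
    where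
    inside : ∀ a → i′ ∸ ℓ < a → a ≤ i′ → countsF k ℓ n π (suc i′) a ≡ true
    inside a i′∸ℓ<a a≤i′ = counted a (subst (_< a) (sym r≡0) (≤-<-trans z≤n i′∸ℓ<a)) a≤i′ i′∸ℓ<a (inj₁ r≡0)
    outside : ∀ a → 1 ≤ a → a ≤ n → (a ≤ i′ ∸ ℓ ⊎ i′ < a) → countsF k ℓ n π (suc i′) a ≡ false
    outside a 1≤a _ (inj₁ a≤i′∸ℓ) = uncounted-far a 1≤a a≤i′∸ℓ
    outside a _   _ (inj₂ i′<a)   = uncounted-right a i′<a

  F-runAfterHole : 1 ≤ r → F k ℓ n π (suc i′) ≡ (i′ ∸ (r + k)) ⊓ ℓ
  F-runAfterHole 1≤r = trans (countUpTo-interval (countsF k ℓ n π (suc i′)) (<⇒≤ i≤n) inside outside)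
                             (m∸[n⊔[m∸o]]≡[m∸n]⊓o i′ (r + k) ℓ)
    where
    inside : ∀ a → (r + k) ⊔ (i′ ∸ ℓ) < a → a ≤ i′ → countsF k ℓ n π (suc i′) a ≡ true
    inside a s<a a≤i′ = counted a (≤-<-trans (m≤m+n r k) r+k<a) a≤i′ (m⊔n<o⇒n<o (r + k) _ s<a) (inj₂ r+k<a)
      where r+k<a = m⊔n<o⇒m<o (r + k) _ s<a
    outside : ∀ a → 1 ≤ a → a ≤ n → (a ≤ (r + k) ⊔ (i′ ∸ ℓ) ⊎ i′ < a) → countsF k ℓ n π (suc i′) a ≡ false
    outside a _   _ (inj₂ i′<a) = uncounted-right a i′<a
    outside a 1≤a _ (inj₁ a≤s) with ⊔-sel (r + k) (i′ ∸ ℓ)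
    ... | inj₂ s≡i′∸ℓ = uncounted-far a 1≤a (subst (a ≤_) s≡i′∸ℓ a≤s)
    ... | inj₁ s≡r+k with a ≤? r
    ...   | yes a≤r = uncounted-atOrBeforeHole a 1≤r a≤r
    ...   | no  a≰r = uncounted-backsIntoHole a 1≤r (≰⇒> a≰r) (subst (a ≤_) s≡r+k a≤s)

IsLeft⇒run : ∀ π {i′ L} → IsLeft π (suc i′) L → ∀ t → i′ ∸ L < t → t ≤ i′ → occ π (suc i′) t ≡ true
IsLeft⇒run π ((L≤i′ , occupied) , _) t i′∸L<t t≤i′ =
  to T-≡ (occupied t (subst (_≤ t) (sym (+-∸-assoc 1 L≤i′)) i′∸L<t) (s≤s t≤i′))

IsLeft⇒hole : ∀ π {i′ L} → IsLeft π (suc i′) L → 1 ≤ i′ ∸ L → occ π (suc i′) (i′ ∸ L) ≡ false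
IsLeft⇒hole π {i′} {L} isLeft@((L≤i′ , _) , maximal) 1≤i′∸L = ¬-not λ occupied →
  contradiction (maximal (suc L) (1+L≤i′ , extended occupied)) 1+n≰n
  where
  1+L≤i′ : suc L ≤ i′
  1+L≤i′ = subst (suc L ≤_) (m∸n+n≡m L≤i′) (+-monoˡ-≤ L 1≤i′∸L)
  extended : occ π (suc i′) (i′ ∸ L) ≡ true → ∀ t → i′ ∸ L ≤ t → t < suc i′ → T (occ π (suc i′) t)
  extended occupied t i′∸L≤t t<i with m≤n⇒m<n∨m≡n i′∸L≤t
  ... | inj₂ refl    = from T-≡ occupied
  ... | inj₁ i′∸L<t = from T-≡ (IsLeft⇒run π isLeft t i′∸L<t (s≤s⁻¹ t<i))

lemma2p12 : (k ℓ m n : ℕ) → 1 ≤ m → m ≤ n → (π : List ℕ) → InS m n π →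
    (i : ℕ) → 1 ≤ i → i ≤ n → 0 < get π i →
    (L : ℕ) → IsLeft π i L →
    ((L ≡ 0 → F k ℓ n π i ≡ 0)
     × (0 < L → L ≡ i ∸ 1 → F k ℓ n π i ≡ (i ∸ 1) ⊓ ℓ)
     × (0 < L → L < i ∸ 1 → F k ℓ n π i ≡ ((L ∸ k) ⊓ ℓ) ⊔ 0))
-- Only which spots are occupied matters.
lemma2p12 k ℓ _ n _ _ π _ (suc i′) _ i≤n _ L isLeft@((L≤i′ , _) , _) =
  F-L≡0 , (λ _ → F-wholeRun) , (λ _ L<i′ → trans (F-partialRun L<i′) (sym (⊔-identityʳ _)))
  where
  open OccupiedRun k ℓ n π i≤n (m∸n≤m i′ L) (IsLeft⇒run π isLeft) (IsLeft⇒hole π isLeft)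
  F-wholeRun : L ≡ i′ → F k ℓ n π (suc i′) ≡ i′ ⊓ ℓ
  F-wholeRun L≡i′ = F-runFromStart (m≤n⇒m∸n≡0 (≤-reflexive (sym L≡i′)))
  F-partialRun : L < i′ → F k ℓ n π (suc i′) ≡ (L ∸ k) ⊓ ℓ
  F-partialRun L<i′ = trans (F-runAfterHole (m<n⇒0<n∸m L<i′))
    (cong (_⊓ ℓ) (trans (sym (∸-+-assoc i′ (i′ ∸ L) k)) (cong (_∸ k) (m∸[m∸n]≡n L≤i′))))
  F-L≡0 : L ≡ 0 → F k ℓ n π (suc i′) ≡ 0
  F-L≡0 refl with m≤n⇒m<n∨m≡n L≤i′
  ... | inj₁ 0<i′ = trans (F-partialRun 0<i′) (cong (_⊓ ℓ) (0∸n≡0 k))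
  ... | inj₂ refl = F-wholeRun refl
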